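{- Let $K$ be a cubic field with fundamental discriminant, let $F_K=(a,b,c,d)$ be an associated binary cubic form with Hessian $H_K=(P,Q,R)$, $P=b^2-3ac$, $Q=bc-9ad$, $R=c^2-3bd$. Then the binary quadratic form $X\mapsto\frac12\mathrm{tr}_{K/\mathbb{Q}}(X^2)$ on $O_K^0$ is, in the indicated $\mathbb{Z}$-basis of $O_K^0$: $(P/3,\,Q,\,3R)$ in the basis $\{\alpha_0,3\beta_0\}$ if $b\equiv0\pmod3$; $(3P,\,Q,\,R/3)$ in the basis $\{3\alpha_0,\beta_0\}$ if $c\equiv0\pmod3$; $(3P,\,2P-Q,\,\frac{P+R-Q}{3})$ in the basis $\{\alpha_0-\beta_0,3\beta_0\}$ if $b\equiv-c\pmod3$; $(3P,\,2P+Q,\,\frac{P+Q+R}{3})$ in the basis $\{\alpha_0+\beta_0,3\beta_0\}$ if $b\equiv c\pmod3$.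
   Context: A fundamental discriminant is the discriminant of a quadratic field. $(A,B,C)$ denotes $Ax^2+Bxy+Cy^2$; $(a,b,c,d)$ denotes $ax^3+bx^2y+cxy^2+dy^3$. By Delone–Faddeev, $K$ has an associated integral binary cubic form $F_K=(a,b,c,d)$ (unique up to $\mathrm{GL}_2(\mathbb{Z})$) of discriminant $d_K$ such that for a root $\theta$ of $F_K(x,1)$, $K=\mathbb{Q}(\theta)$ and $\{1,-a\theta,d/\theta\}$ is a $\mathbb{Z}$-basis of $O_K$. Set $\alpha=-a\theta$, $\beta=d/\theta$, $\alpha_0=\alpha-\mathrm{tr}_{K/\mathbb{Q}}(\alpha)/3$, $\beta_0=\beta-\mathrm{tr}_{K/\mathbb{Q}}(\beta)/3$, and $O_K^0=\{x\in O_K:\mathrm{tr}_{K/\mathbb{Q}}(x)=0\}$; in each case the indicated pair is a $\mathbb{Z}$-basis of $O_K^0$. -}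

module Defs where

open import Data.Nat using (ℕ)
open import Data.Nat.Divisibility using () renaming (_∣_ to _∣ℕ_)
open import Data.Integer as ℤ using (ℤ; +_; ∣_∣)
open import Data.Integer.Divisibility using (_∣_)
open import Data.Rational as ℚ using (ℚ; 0ℚ; 1ℚ; _/_; ≢-nonZero; 1/_)
open import Data.Rational.Properties using (_≟_)
open import Data.Product using (_×_; _,_; Σ)
open import Data.Sum using (_⊎_)
open import Relation.Nullary using (¬_; yes; no)
open import Relation.Binary.PropositionalEquality using (_≡_; _≢_)

-- Integers into ℚ, and a total reciprocal (recip 0 = 0, only used at a ≠ 0)

ι : ℤ → ℚ
ι n = n / 1

recip : ℚ → ℚ
recip p with p ≟ 0ℚ
... | yes _ = 0ℚ
... | no ne = 1/_ p {{≢-nonZero ne}}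

-- Binary cubic forms (a,b,c,d) = a x³ + b x² y + c x y² + d y³

disc : ℤ → ℤ → ℤ → ℤ → ℤ
disc a b c d = b ℤ.* b ℤ.* c ℤ.* c
             ℤ.- + 4 ℤ.* a ℤ.* c ℤ.* c ℤ.* c
             ℤ.- + 4 ℤ.* b ℤ.* b ℤ.* b ℤ.* d
             ℤ.- + 27 ℤ.* a ℤ.* a ℤ.* d ℤ.* d
             ℤ.+ + 18 ℤ.* a ℤ.* b ℤ.* c ℤ.* d

HP HQ HR : ℤ → ℤ → ℤ → ℤ → ℤ
HP a b c d = b ℤ.* b ℤ.- + 3 ℤ.* a ℤ.* c
HQ a b c d = b ℤ.* c ℤ.- + 9 ℤ.* a ℤ.* d
HR a b c d = c ℤ.* c ℤ.- + 3 ℤ.* b ℤ.* d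

-- F(x,1) = a x³ + b x² + c x + d is irreducible over ℚ (a cubic polynomial):
-- leading coefficient nonzero and no factorisation into a linear times a
-- quadratic polynomial over ℚ (the only possible nontrivial factorisation).
IrreducibleCubic : ℤ → ℤ → ℤ → ℤ → Set
IrreducibleCubic a b c d =
  (a ≢ + 0) ×
  (∀ (p1 p0 q2 q1 q0 : ℚ) →
     ¬ ((ι a ≡ p1 ℚ.* q2) × (ι b ≡ p1 ℚ.* q1 ℚ.+ p0 ℚ.* q2) ×
        (ι c ≡ p1 ℚ.* q0 ℚ.+ p0 ℚ.* q1) × (ι d ≡ p0 ℚ.* q0)))

Squarefree : ℤ → Set
Squarefree m = ∀ (k : ℕ) → _∣ℕ_ (k Data.Nat.* k) ∣ m ∣ → k ≡ 1

Fundamental : ℤ → Set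
Fundamental D =
  (D ≢ + 1) ×
  ( (Σ ℤ λ q → (D ≡ + 1 ℤ.+ + 4 ℤ.* q) × Squarefree D)
  ⊎ (Σ ℤ λ m → (D ≡ + 4 ℤ.* m) × (_∣_ (+ 4) (m ℤ.- + 2) ⊎ _∣_ (+ 4) (m ℤ.- + 3)) × Squarefree m))
  where open import Data.Nat using (_*_)

-- The cubic field K = ℚ(θ) ≅ ℚ[x]/(a x³ + b x² + c x + d), a ≠ 0.
-- An element (x₀ , x₁ , x₂) stands for x₀ + x₁ θ + x₂ θ².

K : Set
K = ℚ × ℚ × ℚ

module CubicField (a b c d : ℤ) where

  -- θ³ = r₂ θ² + r₁ θ + r₀
  r0 r1 r2 : ℚ
  r0 = ℚ.- (ι d ℚ.* recip (ι a))
  r1 = ℚ.- (ι c ℚ.* recip (ι a))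
  r2 = ℚ.- (ι b ℚ.* recip (ι a))

  mulθ : K → K
  mulθ (x0 , x1 , x2) = (r0 ℚ.* x2 , x0 ℚ.+ r1 ℚ.* x2 , x1 ℚ.+ r2 ℚ.* x2)

  embed : ℚ → K
  embed q = (q , 0ℚ , 0ℚ)

  θ : K
  θ = (0ℚ , 1ℚ , 0ℚ)

  scale : ℚ → K → K
  scale q (x0 , x1 , x2) = (q ℚ.* x0 , q ℚ.* x1 , q ℚ.* x2)

  _⊕_ : K → K → K
  (x0 , x1 , x2) ⊕ (y0 , y1 , y2) = (x0 ℚ.+ y0 , x1 ℚ.+ y1 , x2 ℚ.+ y2)

  _⊖_ : K → K → K
  x ⊖ y = x ⊕ scale (ℚ.- 1ℚ) y

  _⊗_ : K → K → K
  x ⊗ (y0 , y1 , y2) = scale y0 x ⊕ (scale y1 (mulθ x) ⊕ scale y2 (mulθ (mulθ x)))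

  proj0 proj1 proj2 : K → ℚ
  proj0 (x0 , _ , _) = x0
  proj1 (_ , x1 , _) = x1
  proj2 (_ , _ , x2) = x2

  tr : K → ℚ
  tr x = proj0 (x ⊗ (1ℚ , 0ℚ , 0ℚ)) ℚ.+ proj1 (x ⊗ θ) ℚ.+ proj2 (x ⊗ (0ℚ , 0ℚ , 1ℚ))

  traceless : K → K
  traceless x = x ⊖ embed (tr x ℚ.* (+ 1 / 3))

  TraceFormIs : K → K → ℚ → ℚ → ℚ → Set
  TraceFormIs e1 e2 A B C =
    ∀ (x y : ℤ) →
      let X = scale (ι x) e1 ⊕ scale (ι y) e2 in
      (+ 1 / 2) ℚ.* tr (X ⊗ X) ≡ A ℚ.* ι x ℚ.* ι x ℚ.+ B ℚ.* ι x ℚ.* ι y ℚ.+ C ℚ.* ι y ℚ.* ι y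

-- Write F(x,1) = a (x³ - r₂ x² - r₁ x - r₀), where θ³ = r₂ θ² + r₁ θ + r₀, so that
-- (b, c, d) = -a (r₂, r₁, r₀) and d/θ = a r₁ + a r₂ θ - a θ².  In the basis
-- {α₀, β₀} the form ½ tr(X²) is then (P/3, Q/3, R/3), an identity between
-- polynomials in a and the rᵢ.  Each of the four bases arises from {α₀, β₀} by a
-- linear substitution of the coordinates, which turns (P/3, Q/3, R/3) into the
-- stated forms.

module Submission where

open import Defs
open import Data.Integer as ℤ using (ℤ; +_)
open import Data.Integer.Divisibility using (_∣_)
open import Data.Rational as ℚ using (ℚ; _/_)
open import Data.Product using (_×_)
open import Relation.Binary.PropositionalEquality using (_≡_)

open import Data.Empty using (⊥-elim)
open import Data.List using ([]; _∷_)
open import Data.Nat.Coprimality using (1-coprimeTo) renaming (sym to coprime-sym)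
open import Data.Product using (_,_; proj₁; proj₂)
open import Function using (_∘_)
open import Data.Rational using (mkℚ; 0ℚ; 1ℚ; _+_; _*_; -_; _-_)
import Data.Integer.Properties as ℤP
import Data.Rational.Properties as ℚP
open import Algebra.Properties.Group ℚP.+-0-group using (inverseˡ-unique)
open import Relation.Binary.PropositionalEquality
  using (_≢_; refl; sym; trans; subst; cong; cong₂; module ≡-Reasoning)
open import Relation.Nullary using (yes; no)
open import Relation.Nullary.Decidable using (dec⇒maybe)
open import Tactic.RingSolver using (solve)
open import Tactic.RingSolver.Core.AlmostCommutativeRing
  using (AlmostCommutativeRing; fromCommutativeRing)

ℚ-ring : AlmostCommutativeRing _ _
ℚ-ring = fromCommutativeRing ℚP.+-*-commutativeRing (λ x → dec⇒maybe (0ℚ ℚP.≟ x))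

open import Tactic.RingSolver.NonReflective ℚ-ring as Symbolic
  using (Expr; Κ; _⊜_) renaming (_⊕_ to _:+_; _⊗_ to _:*_; ⊝_ to :-_)

ι-mkℚ : ∀ m → ι m ≡ mkℚ m 0 (coprime-sym (1-coprimeTo _))
ι-mkℚ m = ℚP.↥p/↧p≡p (mkℚ m 0 (coprime-sym (1-coprimeTo _)))

ι-* : ∀ m n → ι (m ℤ.* n) ≡ ι m * ι n
ι-* m n rewrite ι-mkℚ m | ι-mkℚ n = refl

ι-+ : ∀ m n → ι (m ℤ.+ n) ≡ ι m + ι n
ι-+ m n rewrite ι-mkℚ m | ι-mkℚ n =
  cong₂ (λ p q → (p ℤ.+ q) / 1) (sym (ℤP.*-identityʳ m)) (sym (ℤP.*-identityʳ n))

ι-neg : ∀ m → ι (ℤ.- m) ≡ - ι m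
ι-neg m rewrite ι-mkℚ m | ι-mkℚ (ℤ.- m) with m
... | + 0        = refl
... | ℤ.+[1+ _ ] = refl
... | ℤ.-[1+ _ ] = refl

ι-≢0 : ∀ {m} → m ≢ + 0 → ι m ≢ 0ℚ
ι-≢0 {m} m≢0 ιm≡0 = m≢0 (ℚP.p≡0⇒↥p≡0 _ (trans (sym (ι-mkℚ m)) ιm≡0))

ι-hessian : ∀ k x y z w → ι (x ℤ.* y ℤ.- + k ℤ.* z ℤ.* w) ≡ ι x * ι y - ι (+ k) * ι z * ι w
ι-hessian k x y z w = begin
  ι (x ℤ.* y ℤ.- + k ℤ.* z ℤ.* w)           ≡⟨ ι-+ (x ℤ.* y) (ℤ.- (+ k ℤ.* z ℤ.* w)) ⟩
  ι (x ℤ.* y) + ι (ℤ.- (+ k ℤ.* z ℤ.* w))   ≡⟨ cong₂ _+_ (ι-* x y) (ι-neg (+ k ℤ.* z ℤ.* w)) ⟩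
  ι x * ι y - ι (+ k ℤ.* z ℤ.* w)           ≡⟨ cong (λ t → ι x * ι y - t)
                                                 (trans (ι-* (+ k ℤ.* z) w) (cong (_* ι w) (ι-* (+ k) z))) ⟩
  ι x * ι y - ι (+ k) * ι z * ι w           ∎
  where open ≡-Reasoning

recip-inverse : ∀ {p} → p ≢ 0ℚ → recip p * p ≡ 1ℚ
recip-inverse {p} p≢0 with p ℚP.≟ 0ℚ
... | yes p≡0 = ⊥-elim (p≢0 p≡0)
... | no p≢0′ = ℚP.*-inverseˡ p {{ℚ.≢-nonZero p≢0′}}

*-cancelˡ : ∀ {p q r} → p ≢ 0ℚ → p * q ≡ p * r → q ≡ r
*-cancelˡ {p} {q} {r} p≢0 pq≡pr =
  trans (sym (undo q)) (trans (cong (recip p *_) pq≡pr) (undo r))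
  where
  undo : ∀ t → recip p * (p * t) ≡ t
  undo t = trans (sym (ℚP.*-assoc (recip p) p t))
                 (trans (cong (_* t) (recip-inverse p≢0)) (ℚP.*-identityˡ t))

-- With A = ι a this reads b = -a r₂, c = -a r₁, d = -a r₀, as CubicField
-- defines r₂ = -(ι b * recip (ι a)) etc.
recover : ∀ {A} → A ≢ 0ℚ → ∀ p → p ≡ - (A * - (p * recip A))
recover {A} A≢0 p = begin
  p                        ≡⟨ sym (ℚP.*-identityʳ p) ⟩
  p * 1ℚ                   ≡⟨ cong (p *_) (sym (recip-inverse A≢0)) ⟩
  p * (recip A * A)        ≡⟨ rearrange (recip A) ⟩
  - (A * - (p * recip A))  ∎
  where
  open ≡-Reasoning
  rearrange : ∀ u → p * (u * A) ≡ - (A * - (p * u))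
  rearrange u = solve (A ∷ u ∷ p ∷ []) ℚ-ring

hessian-P-monic : ∀ A r₁ r₂ {B C} → B ≡ - (A * r₂) → C ≡ - (A * r₁) →
                  B * B - ι (+ 3) * A * C ≡ A * A * (r₂ * r₂ + ι (+ 3) * r₁)
hessian-P-monic A r₁ r₂ refl refl = solve (A ∷ r₁ ∷ r₂ ∷ []) ℚ-ring

hessian-Q-monic : ∀ A r₀ r₁ r₂ {B C D} → B ≡ - (A * r₂) → C ≡ - (A * r₁) → D ≡ - (A * r₀) →
                  B * C - ι (+ 9) * A * D ≡ A * A * (r₁ * r₂ + ι (+ 9) * r₀)
hessian-Q-monic A r₀ r₁ r₂ refl refl refl = solve (A ∷ r₀ ∷ r₁ ∷ r₂ ∷ []) ℚ-ring

hessian-R-monic : ∀ A r₀ r₁ r₂ {B C D} → B ≡ - (A * r₂) → C ≡ - (A * r₁) → D ≡ - (A * r₀) →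
                  C * C - ι (+ 3) * B * D ≡ A * A * (r₁ * r₁ - ι (+ 3) * r₀ * r₂)
hessian-R-monic A r₀ r₁ r₂ refl refl refl = solve (A ∷ r₀ ∷ r₁ ∷ r₂ ∷ []) ℚ-ring

d/θ-coordinates : ∀ A r₀ r₁ r₂ {y₀ y₁ y₂} → r₀ ≢ 0ℚ →
  r₀ * y₂ ≡ - (A * r₀) → y₀ + r₁ * y₂ ≡ 0ℚ → y₁ + r₂ * y₂ ≡ 0ℚ →
  (y₀ , y₁ , y₂) ≡ (A * r₁ , A * r₂ , - A)
d/θ-coordinates A r₀ r₁ r₂ {y₂ = y₂} r₀≢0 e₀ e₁ e₂ =
  cong₂ _,_ (from-sum r₁ e₁) (cong₂ _,_ (from-sum r₂ e₂) y₂≡-A)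
  where
  y₂≡-A : y₂ ≡ - A
  y₂≡-A = *-cancelˡ r₀≢0 (trans e₀ (solve (A ∷ r₀ ∷ []) ℚ-ring))

  from-sum : ∀ {y} r → y + r * y₂ ≡ 0ℚ → y ≡ A * r
  from-sum {y} r e = trans (inverseˡ-unique y (r * y₂) e)
                             (trans (cong (λ t → - (r * t)) y₂≡-A) (solve (A ∷ r ∷ []) ℚ-ring))

irreducible⇒d≢0 : ∀ {a b c d} → IrreducibleCubic a b c d → d ≢ + 0
irreducible⇒d≢0 {a} {b} {c} (_ , irreducible) refl =
  irreducible 1ℚ 0ℚ (ι a) (ι b) (ι c)
    ( sym (ℚP.*-identityˡ (ι a))
    , sym (trans (cong₂ _+_ (ℚP.*-identityˡ (ι b)) (ℚP.*-zeroˡ (ι a))) (ℚP.+-identityʳ (ι b)))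
    , sym (trans (cong₂ _+_ (ℚP.*-identityˡ (ι c)) (ℚP.*-zeroˡ (ι b))) (ℚP.+-identityʳ (ι c)))
    , sym (ℚP.*-zeroˡ (ι c)) )

pointwise : (ℚ → ℚ → ℚ) → K → K → K
pointwise g (u₀ , u₁ , u₂) (v₀ , v₁ , v₂) = (g u₀ v₀ , g u₁ v₁ , g u₂ v₂)

-- CubicField transcribed into ring-solver expressions, with r₀, r₁, r₂ as
-- variables: evaluating each expression reduces definitionally to the
-- corresponding CubicField operation, so Symbolic.solve proves identities in K.
module Syntax {n} (r₀ r₁ r₂ : Expr ℚ n) where
  Elt : Set
  Elt = Expr ℚ n × Expr ℚ n × Expr ℚ n

  :scale : Expr ℚ n → Elt → Elt
  :scale q (x₀ , x₁ , x₂) = (q :* x₀ , q :* x₁ , q :* x₂)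

  _:⊕_ : Elt → Elt → Elt
  (x₀ , x₁ , x₂) :⊕ (y₀ , y₁ , y₂) = (x₀ :+ y₀ , x₁ :+ y₁ , x₂ :+ y₂)

  :θ : Elt
  :θ = (Κ 0ℚ , Κ 1ℚ , Κ 0ℚ)

  :mulθ : Elt → Elt
  :mulθ (x₀ , x₁ , x₂) = (r₀ :* x₂ , x₀ :+ r₁ :* x₂ , x₁ :+ r₂ :* x₂)

  _:⊗_ : Elt → Elt → Elt
  x :⊗ (y₀ , y₁ , y₂) = :scale y₀ x :⊕ (:scale y₁ (:mulθ x) :⊕ :scale y₂ (:mulθ (:mulθ x)))

  :tr : Elt → Expr ℚ n
  :tr x = proj₁ (x :⊗ (Κ 1ℚ , Κ 0ℚ , Κ 0ℚ))
       :+ proj₁ (proj₂ (x :⊗ :θ))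
       :+ proj₂ (proj₂ (x :⊗ (Κ 0ℚ , Κ 0ℚ , Κ 1ℚ)))

  :traceless : Elt → Elt
  :traceless x = x :⊕ :scale (:- Κ 1ℚ) (:tr x :* Κ (+ 1 / 3) , Κ 0ℚ , Κ 0ℚ)

  :α₀ :β₀ : Expr ℚ n → Elt
  :α₀ A = :traceless (:scale (:- A) :θ)
  :β₀ A = :traceless (A :* r₁ , A :* r₂ , :- A)

  :traceForm : Elt → Expr ℚ n
  :traceForm x = Κ (+ 1 / 2) :* :tr (x :⊗ x)

module TraceForm (a b c d : ℤ) where
  open CubicField a b c d

  traceForm : K → ℚ
  traceForm X = + 1 / 2 * tr (X ⊗ X)

  TraceFormValues : K → K → ℚ → ℚ → ℚ → Set
  TraceFormValues e f A B C = (traceForm e ≡ A) × (tr (e ⊗ f) ≡ B) × (traceForm f ≡ C)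

  traceForm-expand : ∀ e f s t → traceForm (scale s e ⊕ scale t f) ≡
                     traceForm e * s * s + tr (e ⊗ f) * s * t + traceForm f * t * t
  traceForm-expand (e₀ , e₁ , e₂) (f₀ , f₁ , f₂) s t =
    Symbolic.solve 11
      (λ r₀ r₁ r₂ e₀ e₁ e₂ f₀ f₁ f₂ s t →
         let open Syntax r₀ r₁ r₂; e = (e₀ , e₁ , e₂); f = (f₀ , f₁ , f₂) in
         :traceForm (:scale s e :⊕ :scale t f)
         ⊜ (:traceForm e :* s :* s :+ :tr (e :⊗ f) :* s :* t :+ :traceForm f :* t :* t))
      refl r0 r1 r2 e₀ e₁ e₂ f₀ f₁ f₂ s t

  change-of-basis : ∀ {e f A B C} A′ B′ C′ (g₁ g₂ s t : ℚ → ℚ → ℚ) →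
    (∀ x y u v → x * g₁ u v + y * g₂ u v ≡ s x y * u + t x y * v) →
    (∀ x y → A * s x y * s x y + B * s x y * t x y + C * t x y * t x y ≡
             A′ * x * x + B′ * x * y + C′ * y * y) →
    TraceFormValues e f A B C →
    TraceFormIs (pointwise g₁ e f) (pointwise g₂ e f) A′ B′ C′
  change-of-basis {e@(e₀ , e₁ , e₂)} {f@(f₀ , f₁ , f₂)} _ _ _ g₁ g₂ s t
                  basis coefficients (refl , refl , refl) x y =
    trans (cong traceForm in-e,f)
      (trans (traceForm-expand e f (s (ι x) (ι y)) (t (ι x) (ι y))) (coefficients (ι x) (ι y)))
    where
    in-e,f : scale (ι x) (pointwise g₁ e f) ⊕ scale (ι y) (pointwise g₂ e f)
           ≡ scale (s (ι x) (ι y)) e ⊕ scale (t (ι x) (ι y)) f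
    in-e,f = cong₂ _,_ (basis _ _ e₀ f₀) (cong₂ _,_ (basis _ _ e₁ f₁) (basis _ _ e₂ f₂))

  TraceFormIs-e-3f : ∀ {e f P Q R} →
    TraceFormValues e f (P * (+ 1 / 3)) (Q * (+ 1 / 3)) (R * (+ 1 / 3)) →
    TraceFormIs e (scale (ι (+ 3)) f) (P * (+ 1 / 3)) Q (ι (+ 3) * R)
  TraceFormIs-e-3f {e@(_ , _ , _)} {f@(_ , _ , _)} {P} {Q} {R} =
    change-of-basis {e} {f} (P * (+ 1 / 3)) Q (ι (+ 3) * R)
      (λ u _ → u) (λ _ v → ι (+ 3) * v)
      (λ x _ → x) (λ _ y → ι (+ 3) * y)
      (λ x y u v → solve (x ∷ y ∷ u ∷ v ∷ []) ℚ-ring)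
      (λ x y → solve (P ∷ Q ∷ R ∷ x ∷ y ∷ []) ℚ-ring)

  TraceFormIs-3e-f : ∀ {e f P Q R} →
    TraceFormValues e f (P * (+ 1 / 3)) (Q * (+ 1 / 3)) (R * (+ 1 / 3)) →
    TraceFormIs (scale (ι (+ 3)) e) f (ι (+ 3) * P) Q (R * (+ 1 / 3))
  TraceFormIs-3e-f {e@(_ , _ , _)} {f@(_ , _ , _)} {P} {Q} {R} =
    change-of-basis {e} {f} (ι (+ 3) * P) Q (R * (+ 1 / 3))
      (λ u _ → ι (+ 3) * u) (λ _ v → v)
      (λ x _ → ι (+ 3) * x) (λ _ y → y)
      (λ x y u v → solve (x ∷ y ∷ u ∷ v ∷ []) ℚ-ring)
      (λ x y → solve (P ∷ Q ∷ R ∷ x ∷ y ∷ []) ℚ-ring)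

  TraceFormIs-3e-e⊖f : ∀ {e f P Q R} →
    TraceFormValues e f (P * (+ 1 / 3)) (Q * (+ 1 / 3)) (R * (+ 1 / 3)) →
    TraceFormIs (scale (ι (+ 3)) e) (e ⊖ f) (ι (+ 3) * P) (ι (+ 2) * P - Q) ((P + R - Q) * (+ 1 / 3))
  TraceFormIs-3e-e⊖f {e@(_ , _ , _)} {f@(_ , _ , _)} {P} {Q} {R} =
    change-of-basis {e} {f} (ι (+ 3) * P) (ι (+ 2) * P - Q) ((P + R - Q) * (+ 1 / 3))
      (λ u _ → ι (+ 3) * u) (λ u v → u + - 1ℚ * v)
      (λ x y → ι (+ 3) * x + y) (λ _ y → - y)
      (λ x y u v → solve (x ∷ y ∷ u ∷ v ∷ []) ℚ-ring)
      (λ x y → solve (P ∷ Q ∷ R ∷ x ∷ y ∷ []) ℚ-ring)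

  TraceFormIs-3e-e⊕f : ∀ {e f P Q R} →
    TraceFormValues e f (P * (+ 1 / 3)) (Q * (+ 1 / 3)) (R * (+ 1 / 3)) →
    TraceFormIs (scale (ι (+ 3)) e) (e ⊕ f) (ι (+ 3) * P) (ι (+ 2) * P + Q) ((P + Q + R) * (+ 1 / 3))
  TraceFormIs-3e-e⊕f {e@(_ , _ , _)} {f@(_ , _ , _)} {P} {Q} {R} =
    change-of-basis {e} {f} (ι (+ 3) * P) (ι (+ 2) * P + Q) ((P + Q + R) * (+ 1 / 3))
      (λ u _ → ι (+ 3) * u) (λ u v → u + v)
      (λ x y → ι (+ 3) * x + y) (λ _ y → y)
      (λ x y u v → solve (x ∷ y ∷ u ∷ v ∷ []) ℚ-ring)
      (λ x y → solve (P ∷ Q ∷ R ∷ x ∷ y ∷ []) ℚ-ring)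

  θ-mul : ∀ y₀ y₁ y₂ → θ ⊗ (y₀ , y₁ , y₂) ≡ (r0 * y₂ , y₀ + r1 * y₂ , y₁ + r2 * y₂)
  θ-mul y₀ y₁ y₂ =
    cong₂ _,_
      (Symbolic.solve 6 (λ r₀ r₁ r₂ y₀ y₁ y₂ → let open Syntax r₀ r₁ r₂ in
         proj₁ (:θ :⊗ (y₀ , y₁ , y₂)) ⊜ r₀ :* y₂) refl r0 r1 r2 y₀ y₁ y₂)
      (cong₂ _,_
        (Symbolic.solve 6 (λ r₀ r₁ r₂ y₀ y₁ y₂ → let open Syntax r₀ r₁ r₂ in
           proj₁ (proj₂ (:θ :⊗ (y₀ , y₁ , y₂))) ⊜ (y₀ :+ r₁ :* y₂)) refl r0 r1 r2 y₀ y₁ y₂)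
        (Symbolic.solve 6 (λ r₀ r₁ r₂ y₀ y₁ y₂ → let open Syntax r₀ r₁ r₂ in
           proj₂ (proj₂ (:θ :⊗ (y₀ , y₁ , y₂))) ⊜ (y₁ :+ r₂ :* y₂)) refl r0 r1 r2 y₀ y₁ y₂))

  d/θ : K
  d/θ = (ι a * r1 , ι a * r2 , - ι a)

  α₀ : K
  α₀ = traceless (scale (- ι a) θ)

  P Q R : ℚ
  P = ι (HP a b c d)
  Q = ι (HQ a b c d)
  R = ι (HR a b c d)

  traceForm-values-monic :
    TraceFormValues α₀ (traceless d/θ) (ι a * ι a * (r2 * r2 + ι (+ 3) * r1) * (+ 1 / 3))
                          (ι a * ι a * (r1 * r2 + ι (+ 9) * r0) * (+ 1 / 3))
                          (ι a * ι a * (r1 * r1 - ι (+ 3) * r0 * r2) * (+ 1 / 3))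
  traceForm-values-monic =
      Symbolic.solve 4 (λ A r₀ r₁ r₂ → let open Syntax r₀ r₁ r₂ in
        :traceForm (:α₀ A) ⊜ A :* A :* (r₂ :* r₂ :+ Κ (ι (+ 3)) :* r₁) :* Κ (+ 1 / 3))
        refl (ι a) r0 r1 r2
    , Symbolic.solve 4 (λ A r₀ r₁ r₂ → let open Syntax r₀ r₁ r₂ in
        :tr (:α₀ A :⊗ :β₀ A) ⊜ A :* A :* (r₁ :* r₂ :+ Κ (ι (+ 9)) :* r₀) :* Κ (+ 1 / 3))
        refl (ι a) r0 r1 r2
    , Symbolic.solve 4 (λ A r₀ r₁ r₂ → let open Syntax r₀ r₁ r₂ in
        :traceForm (:β₀ A) ⊜ A :* A :* (r₁ :* r₁ :+ :- (Κ (ι (+ 3)) :* r₀ :* r₂)) :* Κ (+ 1 / 3))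
        refl (ι a) r0 r1 r2

  module _ (irreducible : IrreducibleCubic a b c d) where
    private
      ιa≢0 : ι a ≢ 0ℚ
      ιa≢0 = ι-≢0 (proj₁ irreducible)

      b≡-ar2 : ι b ≡ - (ι a * r2)
      b≡-ar2 = recover ιa≢0 (ι b)

      c≡-ar1 : ι c ≡ - (ι a * r1)
      c≡-ar1 = recover ιa≢0 (ι c)

      d≡-ar0 : ι d ≡ - (ι a * r0)
      d≡-ar0 = recover ιa≢0 (ι d)

    hessian-P : P ≡ ι a * ι a * (r2 * r2 + ι (+ 3) * r1)
    hessian-P = trans (ι-hessian 3 b b a c) (hessian-P-monic (ι a) r1 r2 b≡-ar2 c≡-ar1)

    hessian-Q : Q ≡ ι a * ι a * (r1 * r2 + ι (+ 9) * r0)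
    hessian-Q = trans (ι-hessian 9 b c a d) (hessian-Q-monic (ι a) r0 r1 r2 b≡-ar2 c≡-ar1 d≡-ar0)

    hessian-R : R ≡ ι a * ι a * (r1 * r1 - ι (+ 3) * r0 * r2)
    hessian-R = trans (ι-hessian 3 c c b d) (hessian-R-monic (ι a) r0 r1 r2 b≡-ar2 c≡-ar1 d≡-ar0)

    θ⊗y≡d⇒y≡d/θ : ∀ y → θ ⊗ y ≡ embed (ι d) → y ≡ d/θ
    θ⊗y≡d⇒y≡d/θ (y₀ , y₁ , y₂) θ⊗y≡d =
      d/θ-coordinates (ι a) r0 r1 r2 r0≢0 (trans (cong proj₁ coordinates) d≡-ar0)
        (cong (proj₁ ∘ proj₂) coordinates) (cong (proj₂ ∘ proj₂) coordinates)
      where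
      coordinates : (r0 * y₂ , y₀ + r1 * y₂ , y₁ + r2 * y₂) ≡ (ι d , 0ℚ , 0ℚ)
      coordinates = trans (sym (θ-mul y₀ y₁ y₂)) θ⊗y≡d

      r0≢0 : r0 ≢ 0ℚ
      r0≢0 r0≡0 = ι-≢0 {d} (irreducible⇒d≢0 {a} {b} {c} irreducible)
        (trans d≡-ar0 (trans (cong (λ r → - (ι a * r)) r0≡0) (cong -_ (ℚP.*-zeroʳ (ι a)))))

    traceForm-values : ∀ {β} → θ ⊗ β ≡ embed (ι d) →
      TraceFormValues α₀ (traceless β) (P * (+ 1 / 3)) (Q * (+ 1 / 3)) (R * (+ 1 / 3))
    traceForm-values {β} θ⊗β≡d =
      subst (λ y → TraceFormValues α₀ (traceless y) (P * (+ 1 / 3)) (Q * (+ 1 / 3)) (R * (+ 1 / 3)))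
        (sym (θ⊗y≡d⇒y≡d/θ β θ⊗β≡d))
        ( trans (proj₁ traceForm-values-monic) (cong (_* (+ 1 / 3)) (sym hessian-P))
        , trans (proj₁ (proj₂ traceForm-values-monic)) (cong (_* (+ 1 / 3)) (sym hessian-Q))
        , trans (proj₂ (proj₂ traceForm-values-monic)) (cong (_* (+ 1 / 3)) (sym hessian-R)) )

corollary5p3 :
    (a b c d : ℤ) →
    IrreducibleCubic a b c d →
    Fundamental (disc a b c d) →
    let open CubicField a b c d
        P = ι (HP a b c d)
        Q = ι (HQ a b c d)
        R = ι (HR a b c d)
        third = + 1 / 3
        three = ι (+ 3)
    in
    (β : K) → θ ⊗ β ≡ embed (ι d) →
    let α = scale (ℚ.- ι a) θ
        α₀ = traceless α
        β₀ = traceless β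
    in
    ((+ 3) ∣ b → TraceFormIs α₀ (scale three β₀) (P ℚ.* third) Q (three ℚ.* R)) ×
    ((+ 3) ∣ c → TraceFormIs (scale three α₀) β₀ (three ℚ.* P) Q (R ℚ.* third)) ×
    ((+ 3) ∣ (b ℤ.+ c) → TraceFormIs (scale three α₀) (α₀ ⊖ β₀)
                           (three ℚ.* P) (ι (+ 2) ℚ.* P ℚ.- Q) ((P ℚ.+ R ℚ.- Q) ℚ.* third)) ×
    ((+ 3) ∣ (b ℤ.- c) → TraceFormIs (scale three α₀) (α₀ ⊕ β₀)
                           (three ℚ.* P) (ι (+ 2) ℚ.* P ℚ.+ Q) ((P ℚ.+ Q ℚ.+ R) ℚ.* third))
corollary5p3 a b c d irreducible _ β θ⊗β≡d =
    (λ _ → TraceFormIs-e-3f {α₀} {traceless β} {P} {Q} {R} values) ,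
    (λ _ → TraceFormIs-3e-f {α₀} {traceless β} {P} {Q} {R} values) ,
    (λ _ → TraceFormIs-3e-e⊖f {α₀} {traceless β} {P} {Q} {R} values) ,
    (λ _ → TraceFormIs-3e-e⊕f {α₀} {traceless β} {P} {Q} {R} values)
  where
  open CubicField a b c d using (traceless)
  open TraceForm a b c d

  values : TraceFormValues α₀ (traceless β) (P * (+ 1 / 3)) (Q * (+ 1 / 3)) (R * (+ 1 / 3))
  values = traceForm-values irreducible {β} θ⊗β≡d
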